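{- Let $G$ be a connected bipartite graph with bipartition $(A,B)$, with $|A|,|B|\ge2$, that admits no 1-join. Then there exists $a\in A$ such that $G\setminus N[a]$ is connected.
   Context: $G$ admits a 1-join $(V_1,V_2)$ if $(V_1,V_2)$ is a partition of $V(G)$ with $|V_1|,|V_2|\ge2$ and there are subsets $X_1\subseteq V_1$, $X_2\subseteq V_2$ such that $X_1$ is complete to $X_2$ and there are no other edges between $V_1$ and $V_2$. $N[a]$ is the set consisting of $a$ and all its neighbours. -}

module Defs where

open import Data.Nat using (ℕ)
open import Data.Fin using (Fin; _≟_)
open import Data.Bool using (Bool; true; false; T; not; _∨_)
open import Data.Product using (Σ; _×_; ∃-syntax)
open import Relation.Nullary using (¬_; does)
open import Relation.Binary.PropositionalEquality using (_≡_; _≢_)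
open import Function.Bundles using (_⇔_)

record Graph (n : ℕ) : Set where
  field
    adj   : Fin n → Fin n → Bool
    sym   : ∀ u v → adj u v ≡ adj v u
    irrefl : ∀ v → adj v v ≡ false

module _ {n : ℕ} (G : Graph n) where
  open Graph G

  Adj : Fin n → Fin n → Set
  Adj u v = T (adj u v)

  VSet : Set
  VSet = Fin n → Bool

  _∈_ : Fin n → VSet → Set
  v ∈ S = T (S v)

  data Walk (S : VSet) : Fin n → Fin n → Set where
    here : ∀ {u} → u ∈ S → Walk S u u
    step : ∀ {u w v} → u ∈ S → Adj u w → Walk S w v → Walk S u v

  ConnectedOn : VSet → Set
  ConnectedOn S = ∀ u v → u ∈ S → v ∈ S → Walk S u v

  all : VSet
  all _ = true

  Connected : Set
  Connected = ConnectedOn all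

  AtLeast2 : VSet → Set
  AtLeast2 S = Σ (Fin n) λ x → Σ (Fin n) λ y → x ≢ y × x ∈ S × y ∈ S

  -- (A, B) with B = complement of A (given by the Bool predicate inA) is a bipartition:
  -- every edge has one end in A and the other in B
  IsBipartition : VSet → Set
  IsBipartition inA = ∀ u v → Adj u v → inA u ≢ inA v

  complement : VSet → VSet
  complement S v = not (S v)

  Is1Join : VSet → Set
  Is1Join V1 =
    AtLeast2 V1 × AtLeast2 (complement V1) ×
    Σ VSet λ X1 → Σ VSet λ X2 →
      (∀ v → v ∈ X1 → v ∈ V1) × (∀ v → v ∈ X2 → v ∈ complement V1) ×
      (∀ u v → u ∈ V1 → v ∈ complement V1 → (Adj u v ⇔ (u ∈ X1 × v ∈ X2)))

  Admits1Join : Set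
  Admits1Join = Σ VSet Is1Join

  N[_] : Fin n → VSet
  N[ a ] v = does (a ≟ v) ∨ adj a v

  minusN : Fin n → VSet
  minusN a = complement N[ a ]

-- Keep a vertex a ∈ A and a connected set C ⊆ G ∖ N[a], and make C strictly larger at every
-- step. While C is not closed in G ∖ N[a], add a neighbour. Once it is closed, it is a component
-- of G ∖ N[a]; if it is all of G ∖ N[a] we are done. Otherwise every neighbour of C outside C lies
-- in M = frontier = {m ∈ N(a) : m has a neighbour in C}, nonempty as G is connected. If A ∖ C were
-- complete to M, then (C ∪ M, rest) with X₁ = M and X₂ = A ∖ C would be a 1-join: the second side
-- contains a and a vertex of G ∖ N[a] outside C. So some a′ ∈ A ∖ C misses some m ∈ M; then C
-- avoids N[a′] (it is closed and a′ ∉ C) and C ∪ {m} is a larger connected set inside G ∖ N[a′].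
module Submission where

open import Defs
open import Data.Nat using (ℕ; _≤_; _<_; _∸_)
open import Data.Nat.Properties using (∸-monoʳ-<)
open import Data.Nat.Induction using (<-wellFounded)
open import Data.Fin using (Fin; _≟_)
open import Data.Fin.Properties using (any?)
open import Data.Fin.Subset as Subset using (∣_∣)
open import Data.Fin.Subset.Properties using (∣p∣≤n; p⊂q⇒∣p∣<∣q∣)
open import Data.Vec using (tabulate)
open import Data.Vec.Properties using (lookup∘tabulate; lookup⇒[]=; []=⇒lookup)
open import Data.Bool using (true; false; T; not; _∨_; _∧_)
open import Data.Bool.Properties using (T?; T-≡; T-∨; T-∧)
open import Data.Product using (Σ; _×_; _,_; ∃-syntax; proj₁; proj₂)
open import Data.Sum using (_⊎_; inj₁; inj₂; [_,_]′)
open import Data.Empty using (⊥-elim)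
open import Function.Base using (_∘_)
open import Function.Bundles using (mk⇔; Equivalence)
open import Induction.WellFounded using (Acc; acc)
open import Relation.Nullary using (¬_; yes; no; does)
open import Relation.Nullary.Decidable using (_×-dec_; ¬?; decidable-stable; isYes; toWitness; fromWitness)
open import Relation.Binary.PropositionalEquality using (_≡_; _≢_; refl; sym; trans; subst)

T-not⁺ : ∀ {b} → ¬ T b → T (not b)
T-not⁺ {false} _ = _
T-not⁺ {true} ¬b = ¬b _

T-not⁻ : ∀ {b} → T (not b) → ¬ T b
T-not⁻ {false} _ ()

module _ {a ℓ} {State : Set a} {Goal : Set ℓ}
         (size : State → ℕ) {bound : ℕ} (size≤bound : ∀ s → size s ≤ bound) where

  ascend : (∀ s → Goal ⊎ ∃[ s′ ] size s < size s′) → State → Goal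
  ascend advance s = go s (<-wellFounded (bound ∸ size s))
    where
    go : ∀ s → Acc _<_ (bound ∸ size s) → Goal
    go s (acc rs) with advance s
    ... | inj₁ goal = goal
    ... | inj₂ (s′ , s<s′) = go s′ (rs (∸-monoʳ-< s<s′ (size≤bound s′)))

module _ {n : ℕ} (G : Graph n) where
  open Graph G using (adj)

  infix 4 _⊆_

  _⊆_ : VSet G → VSet G → Set
  R ⊆ S = ∀ v → T (R v) → T (S v)

  ∅ : VSet G
  ∅ _ = false

  insert : Fin n → VSet G → VSet G
  insert v S x = does (v ≟ x) ∨ S x

  ∈-insert-self : ∀ v S → T (insert v S v)
  ∈-insert-self v S with v ≟ v
  ... | yes _ = _
  ... | no v≢v = ⊥-elim (v≢v refl)

  ⊆-insert : ∀ v S → S ⊆ insert v S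
  ⊆-insert v S x x∈S = Equivalence.from T-∨ (inj₂ x∈S)

  ∈-insert⁻ : ∀ {v S x} → T (insert v S x) → v ≡ x ⊎ T (S x)
  ∈-insert⁻ {v} {S} {x} p with v ≟ x
  ... | yes v≡x = inj₁ v≡x
  ... | no _ = inj₂ p

  insert-⊆ : ∀ {v R S} → R ⊆ S → T (S v) → insert v R ⊆ S
  insert-⊆ {v} {R} R⊆S v∈S x x∈R′ with ∈-insert⁻ {v} {R} x∈R′
  ... | inj₁ refl = v∈S
  ... | inj₂ x∈R = R⊆S x x∈R

  size : VSet G → ℕ
  size S = ∣ tabulate S ∣

  size≤n : ∀ S → size S ≤ n
  size≤n S = ∣p∣≤n (tabulate S)

  size-insert : ∀ {v S} → ¬ T (S v) → size S < size (insert v S)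
  size-insert {v} {S} v∉S =
    p⊂q⇒∣p∣<∣q∣ ((λ {x} p → ∈-tabulate⁺ (⊆-insert v S x (∈-tabulate⁻ p))) ,
                 v , ∈-tabulate⁺ (∈-insert-self v S) , v∉S ∘ ∈-tabulate⁻)
    where
    ∈-tabulate⁺ : ∀ {R x} → T (R x) → x Subset.∈ tabulate R
    ∈-tabulate⁺ {R} {x} p =
      lookup⇒[]= x (tabulate R) (trans (lookup∘tabulate R x) (Equivalence.to T-≡ p))
    ∈-tabulate⁻ : ∀ {R x} → x Subset.∈ tabulate R → T (R x)
    ∈-tabulate⁻ {R} {x} p =
      Equivalence.from T-≡ (trans (sym (lookup∘tabulate R x)) ([]=⇒lookup p))

  Adj-sym : ∀ {u v} → Adj G u v → Adj G v u
  Adj-sym {u} {v} = subst T (Graph.sym G u v)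

  walk-start : ∀ {S u v} → Walk G S u v → T (S u)
  walk-start (here u∈S) = u∈S
  walk-start (step u∈S _ _) = u∈S

  infixr 5 _++ʷ_

  _++ʷ_ : ∀ {S u v w} → Walk G S u v → Walk G S v w → Walk G S u w
  here _ ++ʷ q = q
  step u∈S uw p ++ʷ q = step u∈S uw (p ++ʷ q)

  reverseʷ : ∀ {S u v} → Walk G S u v → Walk G S v u
  reverseʷ (here u∈S) = here u∈S
  reverseʷ (step u∈S uw p) = reverseʷ p ++ʷ step (walk-start p) (Adj-sym uw) (here u∈S)

  mapʷ : ∀ {R S u v} → R ⊆ S → Walk G R u v → Walk G S u v
  mapʷ R⊆S (here {u} u∈R) = here (R⊆S u u∈R)
  mapʷ R⊆S (step {u} u∈R uw p) = step (R⊆S u u∈R) uw (mapʷ R⊆S p)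

  leaving-edge : ∀ {S C : VSet G} {u v} → Walk G S u v → T (C u) → ¬ T (C v) →
                 ∃[ x ] ∃[ y ] T (C x) × ¬ T (C y) × Adj G x y
  leaving-edge (here _) u∈C v∉C = ⊥-elim (v∉C u∈C)
  leaving-edge {C = C} (step {u} {w} _ uw p) u∈C v∉C with T? (C w)
  ... | yes w∈C = leaving-edge {C = C} p w∈C v∉C
  ... | no w∉C = u , w , u∈C , w∉C , uw

  RootedAt : VSet G → Fin n → Set
  RootedAt C r = T (C r) × (∀ v → T (C v) → Walk G C r v)

  rooted⇒connected : ∀ {C r} → RootedAt C r → ConnectedOn G C
  rooted⇒connected (_ , reach) u v u∈C v∈C = reverseʷ (reach u u∈C) ++ʷ reach v v∈C

  rooted-insert : ∀ {C r c m} → RootedAt C r → T (C c) → Adj G c m → RootedAt (insert m C) r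
  rooted-insert {C} {r} {c} {m} (r∈C , reach) c∈C cm = ⊆-insert m C r r∈C , reach′
    where
    reach′ : ∀ v → T (insert m C v) → Walk G (insert m C) r v
    reach′ v v∈C′ with ∈-insert⁻ {m} {C} v∈C′
    ... | inj₂ v∈C = mapʷ (⊆-insert m C) (reach v v∈C)
    ... | inj₁ refl = mapʷ (⊆-insert m C) (reach c c∈C)
                      ++ʷ step (⊆-insert m C c c∈C) cm (here (∈-insert-self m C))

  rooted-singleton : ∀ v → RootedAt (insert v ∅) v
  rooted-singleton v = ∈-insert-self v ∅ , reach
    where
    reach : ∀ x → T (insert v ∅ x) → Walk G (insert v ∅) v x
    reach x x∈ with ∈-insert⁻ {v} {∅} x∈
    ... | inj₁ refl = here x∈

  connectedOn-resp : ∀ {R S} → R ⊆ S → S ⊆ R → ConnectedOn G R → ConnectedOn G S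
  connectedOn-resp R⊆S S⊆R conn u v u∈S v∈S = mapʷ R⊆S (conn u v (S⊆R u u∈S) (S⊆R v v∈S))

  ClosedIn : VSet G → VSet G → Set
  ClosedIn S C = ∀ u v → T (C u) → T (S v) → Adj G u v → T (C v)

  closed-or-exit : ∀ S C → ClosedIn S C ⊎ ∃[ u ] ∃[ v ] T (C u) × T (S v) × ¬ T (C v) × Adj G u v
  closed-or-exit S C
    with any? (λ u → any? (λ v → T? (C u) ×-dec T? (S v) ×-dec ¬? (T? (C v)) ×-dec T? (adj u v)))
  ... | yes exit = inj₂ exit
  ... | no ¬exit = inj₁ λ u v u∈C v∈S uv →
          decidable-stable (T? (C v)) λ v∉C → ¬exit (u , v , u∈C , v∈S , v∉C , uv)

  ∈-minusN⁺ : ∀ {a v} → a ≢ v → ¬ Adj G a v → T (minusN G a v)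
  ∈-minusN⁺ {a} {v} a≢v ¬av with a ≟ v | adj a v
  ... | yes a≡v | _ = a≢v a≡v
  ... | no _ | true = ¬av _
  ... | no _ | false = _

  ∈-minusN⁻ : ∀ {a v} → T (minusN G a v) → a ≢ v × ¬ Adj G a v
  ∈-minusN⁻ {a} {v} v∈S with a ≟ v | adj a v
  ... | no a≢v | false = a≢v , λ ()

  ∉-minusN⁻ : ∀ {a v} → ¬ T (minusN G a v) → a ≡ v ⊎ Adj G a v
  ∉-minusN⁻ {a} {v} v∉S with a ≟ v | adj a v
  ... | yes a≡v | _ = inj₁ a≡v
  ... | no _ | true = inj₂ _
  ... | no _ | false = ⊥-elim (v∉S _)

  module Bipartite {inA : VSet G} (bip : IsBipartition G inA) where

    A-independent : ∀ {u v} → T (inA u) → T (inA v) → ¬ Adj G u v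
    A-independent {u} {v} u∈A v∈A uv with inA u | inA v | bip u v uv
    ... | true | true | A≢A = A≢A refl

    B-to-A : ∀ {u v} → ¬ T (inA u) → Adj G u v → T (inA v)
    B-to-A {u} {v} u∉A uv with inA u | inA v | bip u v uv
    ... | true | _ | _ = ⊥-elim (u∉A _)
    ... | false | true | _ = _
    ... | false | false | B≢B = B≢B refl

    minusN-recentre : ∀ {a a′} {C : VSet G} → T (inA a) → T (inA a′) →
                      C ⊆ minusN G a → ClosedIn (minusN G a) C → ¬ T (C a′) → C ⊆ minusN G a′
    minusN-recentre {a} {a′} {C} a∈A a′∈A C⊆S closed a′∉C v v∈C with a ≟ a′
    ... | yes refl = C⊆S v v∈C
    ... | no a≢a′ = ∈-minusN⁺ (λ { refl → a′∉C v∈C }) λ a′v →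
            a′∉C (closed v a′ v∈C (∈-minusN⁺ a≢a′ (A-independent a∈A a′∈A)) (Adj-sym a′v))

    module Frontier (conn : Connected G) {a : Fin n} (a∈A : T (inA a)) {C : VSet G} {r : Fin n}
                    (r∈C : T (C r)) (C⊆S : C ⊆ minusN G a) (closed : ClosedIn (minusN G a) C) where

      frontier : VSet G
      frontier v = adj a v ∧ isYes (any? (λ c → T? (C c) ×-dec T? (adj c v)))

      frontier⁺ : ∀ {c v} → Adj G a v → T (C c) → Adj G c v → T (frontier v)
      frontier⁺ {c} av c∈C cv = Equivalence.from T-∧ (av , fromWitness (c , c∈C , cv))

      frontier⁻ : ∀ {v} → T (frontier v) → Adj G a v × ∃[ c ] T (C c) × Adj G c v
      frontier⁻ v∈F with Equivalence.to T-∧ v∈F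
      ... | av , witness = av , toWitness witness

      adjacent⇒∉C : ∀ {v} → Adj G a v → ¬ T (C v)
      adjacent⇒∉C {v} av v∈C = proj₂ (∈-minusN⁻ (C⊆S v v∈C)) av

      frontier-leaving : ∀ {u v} → T (C u) → ¬ T (C v) → Adj G u v → T (frontier v)
      frontier-leaving {u} {v} u∈C v∉C uv with T? (minusN G a v)
      ... | yes v∈S = ⊥-elim (v∉C (closed u v u∈C v∈S uv))
      ... | no v∉S with ∉-minusN⁻ v∉S
      ...   | inj₁ refl = ⊥-elim (adjacent⇒∉C (Adj-sym uv) u∈C)
      ...   | inj₂ av = frontier⁺ av u∈C uv

      a∉C : ¬ T (C a)
      a∉C a∈C = proj₁ (∈-minusN⁻ (C⊆S a a∈C)) refl

      frontier-inhabited : ∃[ w ] ¬ T (C w) × T (frontier w)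
      frontier-inhabited with leaving-edge {C = C} (conn r a _ _) r∈C a∉C
      ... | u , w , u∈C , w∉C , uw = w , w∉C , frontier-leaving u∈C w∉C uw

      frontier⊆B : ∀ {v} → T (frontier v) → ¬ T (inA v)
      frontier⊆B v∈F v∈A = A-independent a∈A v∈A (proj₁ (frontier⁻ v∈F))

      V₁ : VSet G
      V₁ v = C v ∨ frontier v

      V₂ : VSet G
      V₂ = complement G V₁

      C⊆V₁ : C ⊆ V₁
      C⊆V₁ v v∈C = Equivalence.from T-∨ (inj₁ v∈C)

      frontier⊆V₁ : frontier ⊆ V₁
      frontier⊆V₁ v v∈F = Equivalence.from T-∨ (inj₂ v∈F)

      A∖C : VSet G
      A∖C v = inA v ∧ not (C v)

      ∈V₂⁺ : ∀ {v} → ¬ T (C v) → ¬ T (frontier v) → T (V₂ v)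
      ∈V₂⁺ v∉C v∉F = T-not⁺ λ v∈V₁ → [ v∉C , v∉F ]′ (Equivalence.to T-∨ v∈V₁)

      ∈V₂⁻ : ∀ {v} → T (V₂ v) → ¬ T (C v) × ¬ T (frontier v)
      ∈V₂⁻ {v} v∈V₂ = T-not⁻ v∈V₂ ∘ C⊆V₁ v , T-not⁻ v∈V₂ ∘ frontier⊆V₁ v

      frontier-join : ∀ {x} → T (minusN G a x) → ¬ T (C x) →
                      (∀ {a′ m} → T (inA a′) → ¬ T (C a′) → T (frontier m) → Adj G a′ m) →
                      Is1Join G V₁
      frontier-join {x} x∈S x∉C complete with frontier-inhabited
      ... | w , w∉C , w∈F =
        (r , w , (λ r≡w → w∉C (subst (T ∘ C) r≡w r∈C)) , C⊆V₁ r r∈C , frontier⊆V₁ w w∈F) ,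
        (a , x , proj₁ (∈-minusN⁻ x∈S) , ∈V₂⁺ a∉C a∉F , ∈V₂⁺ x∉C x∉F) ,
        frontier , A∖C , frontier⊆V₁ , A∖C⊆V₂ ,
        λ u v u∈V₁ v∈V₂ → mk⇔ (cross u∈V₁ v∈V₂) (λ (u∈F , v∈A∖C) → uncross u∈F v∈A∖C)
        where
        a∉F : ¬ T (frontier a)
        a∉F a∈F = subst T (Graph.irrefl G a) (proj₁ (frontier⁻ a∈F))
        x∉F : ¬ T (frontier x)
        x∉F = proj₂ (∈-minusN⁻ x∈S) ∘ proj₁ ∘ frontier⁻
        A∖C⊆V₂ : A∖C ⊆ V₂
        A∖C⊆V₂ v v∈A∖C with Equivalence.to T-∧ v∈A∖C
        ... | v∈A , v∉C = ∈V₂⁺ (T-not⁻ v∉C) λ v∈F → frontier⊆B v∈F v∈A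
        cross : ∀ {u v} → T (V₁ u) → T (V₂ v) → Adj G u v → T (frontier u) × T (A∖C v)
        cross {u} {v} u∈V₁ v∈V₂ uv with Equivalence.to T-∨ u∈V₁ | ∈V₂⁻ {v} v∈V₂
        ... | inj₁ u∈C | v∉C , v∉F = ⊥-elim (v∉F (frontier-leaving u∈C v∉C uv))
        ... | inj₂ u∈F | v∉C , _ = u∈F , Equivalence.from T-∧ (B-to-A (frontier⊆B u∈F) uv , T-not⁺ v∉C)
        uncross : ∀ {u v} → T (frontier u) → T (A∖C v) → Adj G u v
        uncross u∈F v∈A∖C with Equivalence.to T-∧ v∈A∖C
        ... | v∈A , v∉C = Adj-sym (complete v∈A (T-not⁻ v∉C) u∈F)

    module Ascent (conn : Connected G) (no-1-join : ¬ Admits1Join G) where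

      record Candidate : Set where
        constructor candidate
        field
          {centre} : Fin n
          centre∈A : T (inA centre)
          {part} : VSet G
          {root} : Fin n
          rooted : RootedAt part root
          part⊆ : part ⊆ minusN G centre

      open Candidate

      Solution : Set
      Solution = Σ (Fin n) λ a → T (inA a) × ConnectedOn G (minusN G a)

      module _ {a : Fin n} {C : VSet G} {r : Fin n} (a∈A : T (inA a)) (rooted : RootedAt C r)
               (C⊆S : C ⊆ minusN G a) (closed : ClosedIn (minusN G a) C) where
        open Frontier conn a∈A (proj₁ rooted) C⊆S closed

        recentre : ∀ {a′ m} → T (inA a′) → ¬ T (C a′) → T (frontier m) → ¬ Adj G a′ m →
                   ∃[ c ] size C < size (part c)
        recentre {a′} {m} a′∈A a′∉C m∈F ¬a′m with frontier⁻ m∈F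
        ... | am , c , c∈C , cm =
          candidate a′∈A (rooted-insert rooted c∈C cm) (insert-⊆ C⊆S′ m∈S′) ,
          size-insert (adjacent⇒∉C am)
          where
          C⊆S′ : C ⊆ minusN G a′
          C⊆S′ = minusN-recentre a∈A a′∈A C⊆S closed a′∉C
          m∈S′ : T (minusN G a′ m)
          m∈S′ = ∈-minusN⁺ (λ { refl → frontier⊆B m∈F a′∈A }) ¬a′m

        improve-closed : Solution ⊎ ∃[ c ] size C < size (part c)
        improve-closed with any? (λ x → T? (minusN G a x) ×-dec ¬? (T? (C x)))
        ... | no ¬outside = inj₁ (a , a∈A , connectedOn-resp C⊆S S⊆C (rooted⇒connected rooted))
          where
          S⊆C : minusN G a ⊆ C
          S⊆C x x∈S = decidable-stable (T? (C x)) λ x∉C → ¬outside (x , x∈S , x∉C)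
        ... | yes (x , x∈S , x∉C)
            with any? (λ a′ → any? (λ m →
                   T? (inA a′) ×-dec ¬? (T? (C a′)) ×-dec T? (frontier m) ×-dec ¬? (T? (adj a′ m))))
        ...   | yes (a′ , m , a′∈A , a′∉C , m∈F , ¬a′m) = inj₂ (recentre a′∈A a′∉C m∈F ¬a′m)
        ...   | no ¬gap = ⊥-elim (no-1-join (V₁ , frontier-join x∈S x∉C complete))
          where
          complete : ∀ {a′ m} → T (inA a′) → ¬ T (C a′) → T (frontier m) → Adj G a′ m
          complete {a′} {m} a′∈A a′∉C m∈F =
            decidable-stable (T? (adj a′ m)) λ ¬a′m → ¬gap (a′ , m , a′∈A , a′∉C , m∈F , ¬a′m)

      improve : (c : Candidate) → Solution ⊎ ∃[ c′ ] size (part c) < size (part c′)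
      improve (candidate {a} a∈A {C} rooted C⊆S) with closed-or-exit (minusN G a) C
      ... | inj₁ closed = improve-closed a∈A rooted C⊆S closed
      ... | inj₂ (u , v , u∈C , v∈S , v∉C , uv) =
          inj₂ (candidate a∈A (rooted-insert rooted u∈C uv) (insert-⊆ C⊆S v∈S) , size-insert v∉C)

      initial : ∀ {a a′} → a ≢ a′ → T (inA a) → T (inA a′) → Candidate
      initial {a′ = a′} a≢a′ a∈A a′∈A =
        candidate a∈A (rooted-singleton a′)
                  (insert-⊆ (λ _ ()) (∈-minusN⁺ a≢a′ (A-independent a∈A a′∈A)))

      solve : Candidate → Solution
      solve = ascend (size ∘ part) (size≤n ∘ part) improve

mainTheorem17 : (n : ℕ) (G : Graph n) (inA : VSet G) →
    Connected G → IsBipartition G inA →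
    AtLeast2 G inA → AtLeast2 G (complement G inA) →
    ¬ Admits1Join G →
    Σ (Fin n) λ a → _∈_ G a inA × ConnectedOn G (minusN G a)
mainTheorem17 n G inA conn bip (a , a′ , a≢a′ , a∈A , a′∈A) _ no-1-join =
  solve (initial a≢a′ a∈A a′∈A)
  where
  open Bipartite G bip
  open Ascent conn no-1-join
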